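{- Let $G$ be an oriented graph derived from a Burling tree $T$ and let $uv$ be a top arc of $G$ with respect to $T$ such that $u$ is a source of $G$. Let $G'$ be the oriented graph obtained from $G$ by removing the arc $uv$ and adding a new vertex $w$ together with the arcs $wv$ and $wu$. Then $G'$ can be derived from a Burling tree $T'$ in such a way that $wv$ is a top arc of $G'$ with respect to $T'$, $wu$ is a bottom arc of $G'$ with respect to $T'$, every top arc of $G$ with respect to $T$ other than $uv$ is a top arc of $G'$ with respect to $T'$, and every bottom arc of $G$ with respect to $T$ other than $uv$ is a bottom arc of $G'$ with respect to $T'$.
   Context: Rooted trees: for a rooted tree $(T,r)$ and $v\neq r$, $p(v)$ is the parent of $v$. A branch is a path $v_1v_2\dots v_k$ of $T$ with $v_i$ the parent of $v_{i+1}$ for all $i$ (it starts at $v_1$); a branch may be empty. A Burling tree is a 4-tuple $(T,r,\ell,c)$ where $T$ is a rooted tree with root $r$; $\ell$ assigns to every non-leaf vertex $v$ one of its children $\ell(v)$, the last-born of $v$; and $c$ is a function on $V(T)$ such that if $v\neq r$ is not a last-born then $c(v)$ is the vertex set of a (possibly empty) branch of $T$ starting at $\ell(p(v))$, while $c(v)=\varnothing$ if $v$ is the root or a last-born. The oriented graph fully derived from the Burling tree has vertex set $V(T)$ and an arc $uv$ iff $v\in c(u)$. An oriented graph $G$ is derived from the Burling tree if it is an induced subgraph of the fully derived oriented graph. For such $G$ and an arc $uv$ of $G$, all out-neighbours of $u$ in $G$ lie on the branch $c(u)$; $uv$ is a top arc with respect to $T$ if $v$ is the out-neighbour of $u$ in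 $G$ closest in $T$ to the root, and a bottom arc with respect to $T$ if $v$ is the out-neighbour of $u$ in $G$ furthest in $T$ from the root. -}

module Defs where

open import Data.Nat using (ℕ; zero; suc; _≤_)
open import Data.Fin using (Fin; zero; suc)
open import Data.Maybe using (Maybe; just; nothing)
open import Data.List using (List; []; _∷_)
open import Data.List.Membership.Propositional using (_∈_)
open import Data.Product using (Σ; _×_; _,_)
open import Data.Empty using (⊥)
open import Data.Unit using (⊤)
open import Data.Sum using (_⊎_)
open import Relation.Nullary using (¬_)
open import Relation.Binary.PropositionalEquality using (_≡_; _≢_)
open import Function.Bundles using (_⇔_)
open import Function.Definitions using (Injective)

module TreeNotions {N : ℕ} (par : Fin N → Maybe (Fin N)) where

  data Anc (x : Fin N) : Fin N → Set where
    here : Anc x x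
    step : ∀ {y z} → par z ≡ just y → Anc x y → Anc x z

  data Depth : Fin N → ℕ → Set where
    base : ∀ {z} → par z ≡ nothing → Depth z 0
    step : ∀ {y z n} → par z ≡ just y → Depth y n → Depth z (suc n)

  data Chain : List (Fin N) → Set where
    single : ∀ {x} → Chain (x ∷ [])
    cons   : ∀ {x y rest} → par y ≡ just x → Chain (y ∷ rest) → Chain (x ∷ y ∷ rest)

  BranchFrom : Fin N → List (Fin N) → Set
  BranchFrom s []      = ⊤
  BranchFrom s (x ∷ L) = (x ≡ s) × Chain (x ∷ L)

-- Burling trees (T, r, ℓ, c) with V(T) = Fin N.
-- par v = nothing iff v is the root; ℓ v = nothing iff v is a leaf.
-- c v is given as the branch itself (a list v₁ … vₖ); its vertex set is
-- the set of members of the list.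

record BurlingTree (N : ℕ) : Set where
  field
    root     : Fin N
    par      : Fin N → Maybe (Fin N)
    par-root : par root ≡ nothing
  open TreeNotions par public
  field
    rooted   : ∀ v → Anc root v
    lb       : Fin N → Maybe (Fin N)
    lb-child : ∀ v x → lb v ≡ just x → par x ≡ just v
    lb-leaf  : ∀ v → lb v ≡ nothing → ∀ x → par x ≢ just v
    c        : Fin N → List (Fin N)
    c-root   : c root ≡ []
    c-nonroot : ∀ v p → par v ≡ just p → ∀ q → lb p ≡ just q →
                 (q ≡ v → c v ≡ []) × (q ≢ v → BranchFrom q (c v))

  FullArc : Fin N → Fin N → Set
  FullArc x y = y ∈ c x

Graph : ℕ → Set₁
Graph m = Fin m → Fin m → Set

-- A derivation of G from a Burling tree: G is (isomorphic, via the
-- injective map φ, to) an induced subgraph of the fully derived graph.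
record Derivation {m : ℕ} (G : Graph m) : Set where
  field
    N     : ℕ
    T     : BurlingTree N
    φ     : Fin m → Fin N
    φ-inj : Injective _≡_ _≡_ φ
    arcs  : ∀ x y → G x y ⇔ BurlingTree.FullArc T (φ x) (φ y)

module _ {m : ℕ} {G : Graph m} (D : Derivation G) where
  open Derivation D
  open BurlingTree T

  TopArc : Fin m → Fin m → Set
  TopArc u v = G u v × (∀ x → G u x → ∀ dv dx →
                 Depth (φ v) dv → Depth (φ x) dx → dv ≤ dx)

  BottomArc : Fin m → Fin m → Set
  BottomArc u v = G u v × (∀ x → G u x → ∀ dv dx →
                 Depth (φ v) dv → Depth (φ x) dx → dx ≤ dv)

Source : ∀ {m} → Graph m → Fin m → Set
Source G u = ∀ x → ¬ G x u

-- G' : remove arc uv, add new vertex w (= zero) with arcs wv and wu.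
-- Old vertex x of G is suc x in G'.
extend : ∀ {m} → Graph m → Fin m → Fin m → Graph (suc m)
extend G u v zero    y       = (y ≡ suc v) ⊎ (y ≡ suc u)
extend G u v (suc x) zero    = ⊥
extend G u v (suc x) (suc y) = G x y × ¬ ((x ≡ u) × (y ≡ v))

{-# OPTIONS --safe #-}
-- Subdivide the edge from v to its last-born in T by two new vertices s₁ above s₂, so
-- that ℓ(v) = s₁ and ℓ(s₁) = s₂, and add two more new vertices: u′, a child of s₁ other
-- than s₂, which takes over the role of u, and w, a non-last-born child of the parent of
-- u. Then c(w) is the part of c(u) down to v followed by s₁ u′, and c(u′) is s₂ followed
-- by the part of c(u) below v. As uv is a top arc, u has no out-neighbour in c(u) above
-- v, so w sees exactly v and u′, and u′ sees exactly the other out-neighbours of u; as u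
-- is a source, moving u to u′ affects no other arc (the old copy of u stays in T′ outside
-- the derived graph). The embedding of T into T′ preserves ancestry, and the
-- out-neighbours of a vertex lie on one branch, so depth comparisons between them, hence
-- top and bottom arcs, survive.
module Submission where

open import Defs
open import Data.Nat using (ℕ; suc; _≤_; _<_; s≤s)
open import Data.Nat.Properties using (≤-reflexive; m≤n⇒m≤1+n; <-irrefl; ≤⇒≯)
open import Data.Fin using (Fin; zero; suc; _≟_)
open import Data.Fin.Properties using (suc-injective)
open import Data.Maybe using (Maybe; just; nothing) renaming (map to mapMaybe)
open import Data.Maybe.Properties using (just-injective)
open import Data.List using (List; []; _∷_; _++_; concatMap)
open import Data.List.Properties using (concatMap-++)
open import Data.List.Membership.Propositional using (_∈_; _∉_; lose; find)
open import Data.List.Membership.Propositional.Properties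
  using (∈-∃++; ∈-++⁺ˡ; ∈-++⁺ʳ; ∈-++⁻; ∈-concatMap⁺; ∈-concatMap⁻)
open import Data.List.Relation.Unary.Any using (here; there)
open import Data.Product using (Σ; ∃; _×_; _,_; proj₁; proj₂)
open import Data.Empty using (⊥-elim)
open import Data.Sum using (_⊎_; inj₁; inj₂)
open import Relation.Nullary using (¬_; yes; no)
open import Relation.Binary.PropositionalEquality
open import Function.Base using (_∘_)
open import Function.Bundles using (_⇔_; mk⇔; Equivalence)

module RootedTree {N : ℕ} (par : Fin N → Maybe (Fin N)) where
  open TreeNotions par

  depth-unique : ∀ {x m n} → Depth x m → Depth x n → m ≡ n
  depth-unique (base p) (base q) = refl
  depth-unique (base p) (step q _) with trans (sym p) q
  ... | ()
  depth-unique (step p _) (base q) with trans (sym p) q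
  ... | ()
  depth-unique (step p d) (step q e) with just-injective (trans (sym p) q)
  ... | refl = cong suc (depth-unique d e)

  depth-exists : ∀ {r a} → par r ≡ nothing → Anc r a → ∃ (Depth a)
  depth-exists pr here = 0 , base pr
  depth-exists pr (step p an) with depth-exists pr an
  ... | n , d = suc n , step p d

  Anc-trans : ∀ {a b c} → Anc a b → Anc b c → Anc a c
  Anc-trans ab here = ab
  Anc-trans ab (step p bc) = step p (Anc-trans ab bc)

  AtMostAsDeep : Fin N → Fin N → Set
  AtMostAsDeep a b = ∀ m n → Depth a m → Depth b n → m ≤ n

  Anc⇒AtMostAsDeep : ∀ {a b} → Anc a b → AtMostAsDeep a b
  Anc⇒AtMostAsDeep here m n d e = ≤-reflexive (depth-unique d e)
  Anc⇒AtMostAsDeep (step p an) m n d (base q) with trans (sym p) q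
  ... | ()
  Anc⇒AtMostAsDeep (step p an) m (suc n) d (step q e) with just-injective (trans (sym p) q)
  ... | refl = m≤n⇒m≤1+n (Anc⇒AtMostAsDeep an m n d e)

  ProperAnc : Fin N → Fin N → Set
  ProperAnc a b = ∃ λ p → par b ≡ just p × Anc a p

  ProperAnc⇒depth-< : ∀ {a b m n} → ProperAnc a b → Depth a m → Depth b n → m < n
  ProperAnc⇒depth-< (p , q , an) d (base r) with trans (sym q) r
  ... | ()
  ProperAnc⇒depth-< (p , q , an) d (step r e) with just-injective (trans (sym q) r)
  ... | refl = s≤s (Anc⇒AtMostAsDeep an _ _ d e)

  Anc⇒≡⊎ProperAnc : ∀ {a b} → Anc a b → a ≡ b ⊎ ProperAnc a b
  Anc⇒≡⊎ProperAnc here = inj₁ refl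
  Anc⇒≡⊎ProperAnc (step p an) = inj₂ (_ , p , an)

  child-Anc⇒ProperAnc : ∀ {p c y} → par c ≡ just p → Anc c y → ProperAnc p y
  child-Anc⇒ProperAnc pc here = _ , pc , here
  child-Anc⇒ProperAnc pc (step q an) = _ , q , Anc-trans (step pc here) an

  Chain⇒Anc : ∀ {a b L} → Chain (a ∷ L) → b ∈ a ∷ L → Anc a b
  Chain⇒Anc ch (here refl) = here
  Chain⇒Anc (cons p ch) (there i) = Anc-trans (step p here) (Chain⇒Anc ch i)

  Chain⇒ProperAnc : ∀ {a b L} → Chain (a ∷ L) → b ∈ L → ProperAnc a b
  Chain⇒ProperAnc (cons p ch) i = child-Anc⇒ProperAnc p (Chain⇒Anc ch i)

  Chain-comparable : ∀ {L x y} → Chain L → x ∈ L → y ∈ L → Anc x y ⊎ Anc y x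
  Chain-comparable ch (here refl) j = inj₁ (Chain⇒Anc ch j)
  Chain-comparable ch (there i) (here refl) = inj₂ (Chain⇒Anc ch (there i))
  Chain-comparable (cons _ ch) (there i) (there j) = Chain-comparable ch i j

  Chain-suffix : ∀ xs {y ys} → Chain (xs ++ y ∷ ys) → Chain (y ∷ ys)
  Chain-suffix [] ch = ch
  Chain-suffix (x ∷ []) (cons _ ch) = ch
  Chain-suffix (x ∷ x′ ∷ xs) (cons _ ch) = Chain-suffix (x′ ∷ xs) ch

  Chain-prefix-above : ∀ xs {x y ys} → Chain (xs ++ y ∷ ys) → x ∈ xs → ProperAnc x y
  Chain-prefix-above (x ∷ xs) ch (here refl) = Chain⇒ProperAnc ch (∈-++⁺ʳ xs (here refl))
  Chain-prefix-above (x ∷ x′ ∷ xs) (cons _ ch) (there i) = Chain-prefix-above (x′ ∷ xs) ch i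

  Chain-splice : ∀ xs {y ys zs} → Chain (xs ++ y ∷ ys) → Chain (y ∷ zs) → Chain (xs ++ y ∷ zs)
  Chain-splice [] _ ch = ch
  Chain-splice (x ∷ []) (cons p _) ch = cons p ch
  Chain-splice (x ∷ x′ ∷ xs) (cons p ch′) ch = cons p (Chain-splice (x′ ∷ xs) ch′ ch)

  BranchFrom-++⇒Chain : ∀ xs {q y ys} → BranchFrom q (xs ++ y ∷ ys) → Chain (xs ++ y ∷ ys)
  BranchFrom-++⇒Chain [] (_ , ch) = ch
  BranchFrom-++⇒Chain (x ∷ xs) (_ , ch) = ch

  BranchFrom-splice : ∀ xs {q y ys zs} → BranchFrom q (xs ++ y ∷ ys) → Chain (y ∷ zs) →
                      BranchFrom q (xs ++ y ∷ zs)
  BranchFrom-splice [] (e , _) ch = e , ch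
  BranchFrom-splice (x ∷ xs) (e , ch′) ch = e , Chain-splice (x ∷ xs) ch′ ch

  BranchFrom⇒Anc : ∀ {q L y} → BranchFrom q L → y ∈ L → Anc q y
  BranchFrom⇒Anc {L = x ∷ L} (refl , ch) = Chain⇒Anc ch

  BranchFrom-comparable : ∀ {q L y z} → BranchFrom q L → y ∈ L → z ∈ L → Anc y z ⊎ Anc z y
  BranchFrom-comparable {L = x ∷ L} (_ , ch) = Chain-comparable ch

module BurlingFacts {N : ℕ} (T : BurlingTree N) where
  open BurlingTree T
  open RootedTree par

  root-unique : ∀ {x} → par x ≡ nothing → x ≡ root
  root-unique {x} p with rooted x
  ... | here = refl
  ... | step q _ with trans (sym p) q
  ... | ()

  depth-of : ∀ a → ∃ (Depth a)
  depth-of a = depth-exists par-root (rooted a)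

  ProperAnc-irrefl : ∀ {a} → ¬ ProperAnc a a
  ProperAnc-irrefl {a} pa = let (n , d) = depth-of a in <-irrefl refl (ProperAnc⇒depth-< pa d d)

  ProperAnc⇒¬AtMostAsDeep : ∀ {a b} → ProperAnc b a → ¬ AtMostAsDeep a b
  ProperAnc⇒¬AtMostAsDeep {a} {b} pa h =
    let (da , Da) = depth-of a; (db , Db) = depth-of b
    in ≤⇒≯ (h da db Da Db) (ProperAnc⇒depth-< pa Db Da)

  ∈⇒≢[] : ∀ {y} {L : List (Fin N)} → y ∈ L → L ≢ []
  ∈⇒≢[] (here _) ()
  ∈⇒≢[] (there _) ()

  record ArcSource (a : Fin N) : Set where
    field
      parent first : Fin N
      parent-of    : par a ≡ just parent
      last-born    : lb parent ≡ just first
      branch       : BranchFrom first (c a)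

  arc-source : ∀ {a y} → y ∈ c a → ArcSource a
  arc-source {a} y∈ca with par a in pa
  ... | nothing = ⊥-elim (∈⇒≢[] y∈ca (subst (λ t → c t ≡ []) (sym (root-unique pa)) c-root))
  ... | just p with lb p in lp
  ... | nothing = ⊥-elim (lb-leaf p lp a pa)
  ... | just q with c-nonroot a p pa q lp
  ... | last-born-empty , otherwise-branch = record
    { parent-of = pa ; last-born = lp ; branch = otherwise-branch (∈⇒≢[] y∈ca ∘ last-born-empty) }

  out-neighbours-comparable : ∀ {a y z} → y ∈ c a → z ∈ c a → Anc y z ⊎ Anc z y
  out-neighbours-comparable y∈ca = BranchFrom-comparable (ArcSource.branch (arc-source y∈ca)) y∈ca

module Subdivision {N : ℕ} (T : BurlingTree N) {P q₀ V : Fin N} (prefix tail : List (Fin N))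
  (lb-P : BurlingTree.lb T P ≡ just q₀)
  (branch : TreeNotions.BranchFrom (BurlingTree.par T) q₀ (prefix ++ V ∷ tail)) where
  open BurlingTree T
  open RootedTree par
  open BurlingFacts T

  N′ : ℕ
  N′ = suc (suc (suc (suc N)))

  -- The old children of a hang below attach a, which is s₂ for a = V; accordingly
  -- liftBranch inserts s₁ s₂ right after V.

  pattern w = zero
  pattern u′ = suc zero
  pattern s₁ = suc (suc zero)
  pattern s₂ = suc (suc (suc zero))
  pattern old a = suc (suc (suc (suc a)))

  embed : Fin N → Fin N′
  embed a = old a

  old-injective : ∀ {a b} → _≡_ {A = Fin N′} (old a) (old b) → a ≡ b
  old-injective refl = refl

  attach : Fin N → Fin N′
  attach a with a ≟ V
  ... | yes _ = s₂
  ... | no _ = old a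

  spliced : Fin N → List (Fin N′)
  spliced a with a ≟ V
  ... | yes _ = s₁ ∷ s₂ ∷ []
  ... | no _ = []

  lift : Fin N → List (Fin N′)
  lift a = old a ∷ spliced a

  liftBranch : List (Fin N) → List (Fin N′)
  liftBranch = concatMap lift

  par′ : Fin N′ → Maybe (Fin N′)
  par′ w = just (old P)
  par′ u′ = just s₁
  par′ s₁ = just (old V)
  par′ s₂ = just s₁
  par′ (old a) = mapMaybe attach (par a)

  lb′ : Fin N′ → Maybe (Fin N′)
  lb′ w = nothing
  lb′ u′ = nothing
  lb′ s₁ = just s₂
  lb′ s₂ = mapMaybe embed (lb V)
  lb′ (old a) with a ≟ V
  ... | yes _ = just s₁
  ... | no _ = mapMaybe embed (lb a)

  c′ : Fin N′ → List (Fin N′)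
  c′ w = liftBranch prefix ++ old V ∷ s₁ ∷ u′ ∷ []
  c′ u′ = s₂ ∷ liftBranch tail
  c′ s₁ = []
  c′ s₂ = []
  c′ (old a) = liftBranch (c a)

  module Tree′ = TreeNotions par′
  module Rooted′ = RootedTree par′

  attach-V : attach V ≡ s₂
  attach-V with V ≟ V
  ... | yes _ = refl
  ... | no V≢V = ⊥-elim (V≢V refl)

  attach-old : ∀ {a} → a ≢ V → attach a ≡ old a
  attach-old {a} a≢V with a ≟ V
  ... | yes a≡V = ⊥-elim (a≢V a≡V)
  ... | no _ = refl

  lb′-old-V : lb′ (old V) ≡ just s₁
  lb′-old-V with V ≟ V
  ... | yes _ = refl
  ... | no V≢V = ⊥-elim (V≢V refl)

  lb′-old : ∀ {a} → a ≢ V → lb′ (old a) ≡ mapMaybe embed (lb a)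
  lb′-old {a} a≢V with a ≟ V
  ... | yes a≡V = ⊥-elim (a≢V a≡V)
  ... | no _ = refl

  par′-old : ∀ {a b} → par a ≡ just b → par′ (old a) ≡ just (attach b)
  par′-old p rewrite p = refl

  Anc-old : ∀ {a b} → Anc a b → Tree′.Anc (old a) (old b)
  Anc-old here = Tree′.here
  Anc-old (step {y} p an) = Tree′.step (par′-old p) (towards-attach (Anc-old an))
    where
      towards-attach : Tree′.Anc (old _) (old y) → Tree′.Anc (old _) (attach y)
      towards-attach an′ with y ≟ V
      ... | yes refl = Tree′.step refl (Tree′.step refl an′)
      ... | no _ = an′

  splice-Chain : ∀ {a Z} → Tree′.Chain (attach a ∷ Z) → Tree′.Chain (old a ∷ spliced a ++ Z)
  splice-Chain {a} ch with a ≟ V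
  ... | yes refl = Tree′.cons refl (Tree′.cons refl ch)
  ... | no _ = ch

  liftBranch-Chain : ∀ {a L} → Chain (a ∷ L) → Tree′.Chain (attach a ∷ liftBranch L)
  liftBranch-Chain single = Tree′.single
  liftBranch-Chain (cons p ch) = Tree′.cons (par′-old p) (splice-Chain (liftBranch-Chain ch))

  liftBranch-BranchFrom : ∀ {q L} → BranchFrom q L → Tree′.BranchFrom (old q) (liftBranch L)
  liftBranch-BranchFrom {L = []} _ = _
  liftBranch-BranchFrom {L = x ∷ L} (refl , ch) = refl , splice-Chain (liftBranch-Chain ch)

  ∈-spliced⁻ : ∀ {a x} → x ∈ spliced a → x ≡ s₁ ⊎ x ≡ s₂
  ∈-spliced⁻ {a} i with a ≟ V
  ∈-spliced⁻ (here e) | yes _ = inj₁ e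
  ∈-spliced⁻ (there (here e)) | yes _ = inj₂ e

  ∈-liftBranch⁺ : ∀ {b L} → b ∈ L → old b ∈ liftBranch L
  ∈-liftBranch⁺ b∈L = ∈-concatMap⁺ lift (lose b∈L (here refl))

  ∈-liftBranch⁻ : ∀ {x L} → x ∈ liftBranch L → (∃ λ b → b ∈ L × x ≡ old b) ⊎ (x ≡ s₁ ⊎ x ≡ s₂)
  ∈-liftBranch⁻ i with find (∈-concatMap⁻ lift i)
  ... | b , b∈L , here e = inj₁ (b , b∈L , e)
  ... | _ , _ , there j = inj₂ (∈-spliced⁻ j)

  old-∈-liftBranch⁻ : ∀ L {b} → old b ∈ liftBranch L → b ∈ L
  old-∈-liftBranch⁻ L i with ∈-liftBranch⁻ {L = L} i
  ... | inj₁ (_ , b∈L , refl) = b∈L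
  ... | inj₂ (inj₁ ())
  ... | inj₂ (inj₂ ())

  w∉liftBranch : ∀ L → w ∉ liftBranch L
  w∉liftBranch L i with ∈-liftBranch⁻ {L = L} i
  ... | inj₁ (_ , _ , ())
  ... | inj₂ (inj₁ ())
  ... | inj₂ (inj₂ ())

  u′∉liftBranch : ∀ L → u′ ∉ liftBranch L
  u′∉liftBranch L i with ∈-liftBranch⁻ {L = L} i
  ... | inj₁ (_ , _ , ())
  ... | inj₂ (inj₁ ())
  ... | inj₂ (inj₂ ())

  P≢V : P ≢ V
  P≢V refl = ProperAnc-irrefl
    (child-Anc⇒ProperAnc (lb-child P q₀ lb-P) (BranchFrom⇒Anc branch (∈-++⁺ʳ prefix (here refl))))

  par′-root : par′ (old root) ≡ nothing
  par′-root rewrite par-root = refl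

  rooted′ : ∀ x → Tree′.Anc (old root) x
  rooted′ w = Tree′.step refl (Anc-old (rooted P))
  rooted′ u′ = Tree′.step refl (rooted′ s₁)
  rooted′ s₁ = Tree′.step refl (Anc-old (rooted V))
  rooted′ s₂ = Tree′.step refl (rooted′ s₁)
  rooted′ (old a) = Anc-old (rooted a)

  lb′-child : ∀ x y → lb′ x ≡ just y → par′ y ≡ just x
  lb′-child s₁ y refl = refl
  lb′-child s₂ y e with lb V in lb-V
  lb′-child s₂ y refl | just z = trans (par′-old (lb-child V z lb-V)) (cong just attach-V)
  lb′-child (old a) y e with a ≟ V
  lb′-child (old a) y refl | yes refl = refl
  ... | no a≢V with lb a in lb-a
  lb′-child (old a) y refl | no a≢V | just z = trans (par′-old (lb-child a z lb-a)) (cong just (attach-old a≢V))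

  lifted-parent-not-leaf : ∀ {a b} → par b ≡ just a → mapMaybe embed (lb a) ≢ nothing
  lifted-parent-not-leaf {a} {b} pb with lb a in lb-a
  ... | nothing = λ _ → lb-leaf a lb-a b pb
  ... | just _ = λ ()

  parent′-not-leaf : ∀ y {x} → par′ y ≡ just x → lb′ x ≢ nothing
  parent′-not-leaf w refl rewrite lb′-old P≢V | lb-P = λ ()
  parent′-not-leaf u′ refl = λ ()
  parent′-not-leaf s₁ refl rewrite lb′-old-V = λ ()
  parent′-not-leaf s₂ refl = λ ()
  parent′-not-leaf (old b) p with par b in pb
  parent′-not-leaf (old b) refl | just y with y ≟ V
  ... | yes refl = lifted-parent-not-leaf pb
  ... | no y≢V rewrite lb′-old y≢V = lifted-parent-not-leaf pb

  lb′-leaf : ∀ x → lb′ x ≡ nothing → ∀ y → par′ y ≢ just x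
  lb′-leaf x lx y py = parent′-not-leaf y py lx

  c′-root : c′ (old root) ≡ []
  c′-root rewrite c-root = refl

  w-branch : Tree′.BranchFrom (old q₀) (liftBranch prefix ++ old V ∷ s₁ ∷ u′ ∷ [])
  w-branch = Rooted′.BranchFrom-splice (liftBranch prefix) lifted
               (Tree′.cons refl (Tree′.cons refl Tree′.single))
    where
      lifted : Tree′.BranchFrom (old q₀) (liftBranch prefix ++ liftBranch (V ∷ tail))
      lifted = subst (Tree′.BranchFrom (old q₀)) (concatMap-++ lift prefix (V ∷ tail))
                     (liftBranch-BranchFrom branch)

  u′-chain : Tree′.Chain (s₂ ∷ liftBranch tail)
  u′-chain = subst (λ t → Tree′.Chain (t ∷ liftBranch tail)) attach-V
                   (liftBranch-Chain (Chain-suffix prefix (BranchFrom-++⇒Chain prefix branch)))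

  old-c-nonroot : ∀ {a y q} → par a ≡ just y → mapMaybe embed (lb y) ≡ just q →
                  (q ≡ old a → c′ (old a) ≡ []) × (q ≢ old a → Tree′.BranchFrom q (c′ (old a)))
  old-c-nonroot {a} {y} pa e with lb y in lb-y
  old-c-nonroot {a} {y} pa refl | just q with c-nonroot a y pa q lb-y
  ... | if-last-born , otherwise =
    (λ q≡a → cong liftBranch (if-last-born (old-injective q≡a))) ,
    (λ q≢a → liftBranch-BranchFrom (otherwise (q≢a ∘ cong embed)))

  c′-nonroot : ∀ x p → par′ x ≡ just p → ∀ q → lb′ p ≡ just q →
               (q ≡ x → c′ x ≡ []) × (q ≢ x → Tree′.BranchFrom q (c′ x))
  c′-nonroot w p refl q e with trans (sym e) (trans (lb′-old P≢V) (cong (mapMaybe embed) lb-P))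
  ... | refl = (λ ()) , (λ _ → w-branch)
  c′-nonroot u′ p refl q refl = (λ ()) , (λ _ → refl , u′-chain)
  c′-nonroot s₁ p refl q e with trans (sym e) lb′-old-V
  ... | refl = (λ _ → refl) , (λ q≢s₁ → ⊥-elim (q≢s₁ refl))
  c′-nonroot s₂ p refl q refl = (λ _ → refl) , (λ q≢s₂ → ⊥-elim (q≢s₂ refl))
  c′-nonroot (old a) p pp q e with par a in pa
  c′-nonroot (old a) p refl q e | just y with y ≟ V
  ... | yes refl = old-c-nonroot pa e
  ... | no y≢V = old-c-nonroot pa (trans (sym (lb′-old y≢V)) e)

  T′ : BurlingTree N′
  T′ = record
    { root = old root ; par = par′ ; par-root = par′-root ; rooted = rooted′
    ; lb = lb′ ; lb-child = lb′-child ; lb-leaf = lb′-leaf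
    ; c = c′ ; c-root = c′-root ; c-nonroot = c′-nonroot }

  old-AtMostAsDeep : ∀ {a b} → Anc a b ⊎ Anc b a → AtMostAsDeep a b →
                     Rooted′.AtMostAsDeep (old a) (old b)
  old-AtMostAsDeep (inj₁ a-b) _ = Rooted′.Anc⇒AtMostAsDeep (Anc-old a-b)
  old-AtMostAsDeep (inj₂ b-a) a≼b with Anc⇒≡⊎ProperAnc b-a
  ... | inj₁ refl = Rooted′.Anc⇒AtMostAsDeep Tree′.here
  ... | inj₂ b-above-a = ⊥-elim (ProperAnc⇒¬AtMostAsDeep b-above-a a≼b)

module Extension {m : ℕ} (G : Graph m) (D : Derivation G) (u v : Fin m)
  (top : TopArc D u v) (source : Source G u) (prefix tail : List (Fin (Derivation.N D)))
  (c-u : BurlingTree.c (Derivation.T D) (Derivation.φ D u) ≡ prefix ++ Derivation.φ D v ∷ tail) where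
  open Derivation D
  open BurlingTree T
  open RootedTree par
  open BurlingFacts T

  arc⇒∈ : ∀ {x y} → G x y → φ y ∈ c (φ x)
  arc⇒∈ {x} {y} = Equivalence.to (arcs x y)

  ∈⇒arc : ∀ {x y} → φ y ∈ c (φ x) → G x y
  ∈⇒arc {x} {y} = Equivalence.from (arcs x y)

  u-v : G u v
  u-v = proj₁ top

  open ArcSource (arc-source (arc⇒∈ u-v))

  branch-u : BranchFrom first (prefix ++ φ v ∷ tail)
  branch-u = subst (BranchFrom first) c-u branch

  chain-u : Chain (prefix ++ φ v ∷ tail)
  chain-u = BranchFrom-++⇒Chain prefix branch-u

  open Subdivision T prefix tail last-born branch-u

  target≢u : ∀ {x y} → G x y → y ≢ u
  target≢u {x} g refl = source x g

  φ∉prefix : ∀ {y} → φ y ∉ prefix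
  φ∉prefix {y} i = ProperAnc⇒¬AtMostAsDeep (Chain-prefix-above prefix chain-u i)
    (proj₂ top y (∈⇒arc (subst (_ ∈_) (sym c-u) (∈-++⁺ˡ i))))

  ∈tail⇒arc : ∀ {y} → φ y ∈ tail → G u y
  ∈tail⇒arc i = ∈⇒arc (subst (_ ∈_) (sym c-u) (∈-++⁺ʳ prefix (there i)))

  φv∉tail : φ v ∉ tail
  φv∉tail i = ProperAnc-irrefl (Chain⇒ProperAnc (Chain-suffix prefix chain-u) i)

  φ′ : Fin (suc m) → Fin N′
  φ′ zero = w
  φ′ (suc y) with y ≟ u
  ... | yes _ = u′
  ... | no _ = old (φ y)

  φ′-u : φ′ (suc u) ≡ u′
  φ′-u with u ≟ u
  ... | yes _ = refl
  ... | no u≢u = ⊥-elim (u≢u refl)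

  φ′-old : ∀ {y} → y ≢ u → φ′ (suc y) ≡ old (φ y)
  φ′-old {y} y≢u with y ≟ u
  ... | yes y≡u = ⊥-elim (y≢u y≡u)
  ... | no _ = refl

  φ′-injective : ∀ {x y} → φ′ x ≡ φ′ y → x ≡ y
  φ′-injective {zero} {zero} _ = refl
  φ′-injective {zero} {suc y} e with y ≟ u
  φ′-injective {zero} {suc y} () | yes _
  φ′-injective {zero} {suc y} () | no _
  φ′-injective {suc x} {zero} e with x ≟ u
  φ′-injective {suc x} {zero} () | yes _
  φ′-injective {suc x} {zero} () | no _
  φ′-injective {suc x} {suc y} e with x ≟ u | y ≟ u
  ... | yes refl | yes refl = refl
  φ′-injective {suc x} {suc y} () | yes _ | no _
  φ′-injective {suc x} {suc y} () | no _ | yes _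
  ... | no _ | no _ = cong suc (φ-inj (old-injective e))

  G′ : Graph (suc m)
  G′ = extend G u v

  ∈-c′-w⁻ : ∀ {x} → x ∈ c′ w → x ∈ liftBranch prefix ⊎ x ≡ old (φ v) ⊎ x ≡ s₁ ⊎ x ≡ u′
  ∈-c′-w⁻ i with ∈-++⁻ (liftBranch prefix) i
  ... | inj₁ j = inj₁ j
  ... | inj₂ (here e) = inj₂ (inj₁ e)
  ... | inj₂ (there (here e)) = inj₂ (inj₂ (inj₁ e))
  ... | inj₂ (there (there (here e))) = inj₂ (inj₂ (inj₂ e))

  arcs-from-w : ∀ y → G′ zero y ⇔ (φ′ y ∈ c′ w)
  arcs-from-w zero = mk⇔ (λ { (inj₁ ()) ; (inj₂ ()) }) from
    where
      from : w ∈ c′ w → G′ zero zero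
      from i with ∈-c′-w⁻ i
      ... | inj₁ j = ⊥-elim (w∉liftBranch prefix j)
      ... | inj₂ (inj₁ ())
      ... | inj₂ (inj₂ (inj₁ ()))
      ... | inj₂ (inj₂ (inj₂ ()))
  arcs-from-w (suc y) with y ≟ u
  ... | yes refl = mk⇔ (λ _ → ∈-++⁺ʳ (liftBranch prefix) (there (there (here refl)))) (λ _ → inj₂ refl)
  ... | no y≢u = mk⇔ to from
    where
      to : G′ zero (suc y) → old (φ y) ∈ c′ w
      to (inj₁ refl) = ∈-++⁺ʳ (liftBranch prefix) (here refl)
      to (inj₂ e) = ⊥-elim (y≢u (suc-injective e))
      from : old (φ y) ∈ c′ w → G′ zero (suc y)
      from i with ∈-c′-w⁻ i
      ... | inj₁ j = ⊥-elim (φ∉prefix (old-∈-liftBranch⁻ prefix j))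
      ... | inj₂ (inj₁ e) = inj₁ (cong suc (φ-inj (old-injective e)))
      ... | inj₂ (inj₂ (inj₁ ()))
      ... | inj₂ (inj₂ (inj₂ ()))

  arcs-from-u : ∀ y → G′ (suc u) y ⇔ (φ′ y ∈ c′ u′)
  arcs-from-u zero = mk⇔ (λ ()) λ { (here ()) ; (there i) → ⊥-elim (w∉liftBranch tail i) }
  arcs-from-u (suc y) with y ≟ u
  ... | yes refl = mk⇔ (λ (g , _) → ⊥-elim (source u g))
                       (λ { (here ()) ; (there i) → ⊥-elim (u′∉liftBranch tail i) })
  ... | no y≢u = mk⇔ to from
    where
      to : G′ (suc u) (suc y) → old (φ y) ∈ c′ u′
      to (g , not-uv) with ∈-++⁻ prefix (subst (_ ∈_) c-u (arc⇒∈ g))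
      ... | inj₁ j = ⊥-elim (φ∉prefix j)
      ... | inj₂ (here e) = ⊥-elim (not-uv (refl , φ-inj e))
      ... | inj₂ (there j) = there (∈-liftBranch⁺ j)
      from : old (φ y) ∈ c′ u′ → G′ (suc u) (suc y)
      from (there i) = let φy∈tail = old-∈-liftBranch⁻ tail i in
        ∈tail⇒arc φy∈tail , λ { (_ , refl) → φv∉tail φy∈tail }

  arcs-from-old : ∀ {x} → x ≢ u → ∀ y → G′ (suc x) y ⇔ (φ′ y ∈ c′ (old (φ x)))
  arcs-from-old {x} _ zero = mk⇔ (λ ()) (⊥-elim ∘ w∉liftBranch (c (φ x)))
  arcs-from-old {x} x≢u (suc y) with y ≟ u
  ... | yes refl = mk⇔ (λ (g , _) → ⊥-elim (source x g)) (⊥-elim ∘ u′∉liftBranch (c (φ x)))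
  ... | no _ = mk⇔ (λ (g , _) → ∈-liftBranch⁺ (arc⇒∈ g))
                   (λ i → ∈⇒arc (old-∈-liftBranch⁻ (c (φ x)) i) , λ (x≡u , _) → x≢u x≡u)

  arcs′ : ∀ x y → G′ x y ⇔ BurlingTree.FullArc T′ (φ′ x) (φ′ y)
  arcs′ zero y = arcs-from-w y
  arcs′ (suc x) y with x ≟ u
  ... | yes refl = arcs-from-u y
  ... | no x≢u = arcs-from-old x≢u y

  D′ : Derivation G′
  D′ = record { N = N′ ; T = T′ ; φ = φ′ ; φ-inj = φ′-injective ; arcs = arcs′ }

  v-above-u′ : Rooted′.AtMostAsDeep (φ′ (suc v)) (φ′ (suc u))
  v-above-u′ rewrite φ′-old (target≢u u-v) | φ′-u =
    Rooted′.Anc⇒AtMostAsDeep (Tree′.step refl (Tree′.step refl Tree′.here))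

  w-v-top : TopArc D′ zero (suc v)
  w-v-top = inj₁ refl , λ { (suc y) (inj₁ refl) → Rooted′.Anc⇒AtMostAsDeep Tree′.here
                          ; (suc y) (inj₂ refl) → v-above-u′ }

  w-u-bottom : BottomArc D′ zero (suc u)
  w-u-bottom = inj₂ refl , λ { (suc y) (inj₂ refl) _ _ Du Du′ → ≤-reflexive (Rooted′.depth-unique Du′ Du)
                             ; (suc y) (inj₁ refl) du dv Du Dv → v-above-u′ dv du Dv Du }

  old-out-neighbours-AtMostAsDeep : ∀ {x y z} → G x y → G x z → AtMostAsDeep (φ y) (φ z) →
                                    Rooted′.AtMostAsDeep (φ′ (suc y)) (φ′ (suc z))
  old-out-neighbours-AtMostAsDeep g g′ y≼z
    rewrite φ′-old (target≢u g) | φ′-old (target≢u g′) =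
      old-AtMostAsDeep (out-neighbours-comparable (arc⇒∈ g) (arc⇒∈ g′)) y≼z

  top-preserved : ∀ x y → TopArc D x y → ¬ ((x ≡ u) × (y ≡ v)) → TopArc D′ (suc x) (suc y)
  top-preserved x y (g , shallowest) not-uv =
    (g , not-uv) , λ { (suc z) (g′ , _) → old-out-neighbours-AtMostAsDeep g g′ (shallowest z g′) }

  bottom-preserved : ∀ x y → BottomArc D x y → ¬ ((x ≡ u) × (y ≡ v)) → BottomArc D′ (suc x) (suc y)
  bottom-preserved x y (g , deepest) not-uv =
    (g , not-uv) , λ { (suc z) (g′ , _) dy dz Dy Dz →
      old-out-neighbours-AtMostAsDeep g′ g (λ m n Dz′ Dy′ → deepest z g′ n m Dy′ Dz′) dz dy Dz Dy }

lemma3p7 : ∀ {m} (G : Graph m) (D : Derivation G) (u v : Fin m) →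
    TopArc D u v → Source G u →
    Σ (Derivation (extend G u v)) λ D′ →
      TopArc D′ zero (suc v) × BottomArc D′ zero (suc u) ×
      (∀ x y → TopArc D x y → ¬ ((x ≡ u) × (y ≡ v)) → TopArc D′ (suc x) (suc y)) ×
      (∀ x y → BottomArc D x y → ¬ ((x ≡ u) × (y ≡ v)) → BottomArc D′ (suc x) (suc y))
lemma3p7 G D u v top source with ∈-∃++ (Equivalence.to (Derivation.arcs D u v) (proj₁ top))
... | prefix , tail , c-u = D′ , w-v-top , w-u-bottom , top-preserved , bottom-preserved
  where open Extension G D u v top source prefix tail c-u
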